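{- Let $N\ge 1$ and let $a,b$ be distinct integers with $\gcd(N,a,b)=1$, and suppose the double-step graph $G(N;\pm a,\pm b)$ has diameter $k$. Let $N\!A$ be the New Amsterdam digraph on $2N$ vertices with steps $$\alpha=-1,\qquad \beta=2(b-a)-1,\qquad \gamma=2a+1,\qquad \delta=-2b+1,$$ that is, the digraph with vertex set $\mathbb{Z}_{2N}$ in which every even vertex $i$ has arcs to $i+\alpha$ and $i+\beta$, and every odd vertex $j$ has arcs to $j+\gamma$ and $j+\delta$ (arithmetic modulo $2N$). Then the diameter $D_{NA}$ of $N\!A$ satisfies $$2k\le D_{NA}\le 2k+1.$$
   Context: A double-step graph $G(N;\pm a,\pm b)$ has vertex set $\mathbb{Z}_N$, and each vertex $i$ is adjacent to $i\pm a$ and $i\pm b$ (mod $N$), where $a,b$ are distinct integers (the steps) with $\gcd(N,a,b)=1$; its diameter is the usual graph diameter. A New Amsterdam digraph $N\!A(M;\alpha,\beta,\gamma,\delta)$, for even $M$ and odd integers $\alpha\neq\beta,\gamma,\delta$ with $\alpha+\beta+\gamma+\delta\equiv 0 \pmod M$, is the bipartite digraph on $\mathbb{Z}_M$ where each even vertex $i$ has arcs to $i+\alpha,i+\beta$ and each odd vertex $j$ has arcs to $j+\gamma,j+\delta$ (mod $M$). The diameter of a digraph is the maximum, over ordered pairs of vertices $(u,v)$, of the length of a shortest directed path from $u$ to $v$. -}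

module Defs where

open import Data.Nat using (ℕ; zero; suc) renaming (_≤_ to _≤ℕ_; _<_ to _<ℕ_)
open import Data.Integer using (ℤ; +_; _+_; _-_; -_; _*_)
open import Data.Integer.Divisibility using (_∣_)
open import Data.Fin using (Fin; toℕ)
open import Data.Product using (Σ; ∃; ∃-syntax; _×_; _,_)
open import Data.Sum using (_⊎_)
open import Relation.Nullary using (¬_)

-- congruence modulo M on the integers (ℤ_M is represented by ℤ up to this relation)
_≡_[mod_] : ℤ → ℤ → ℕ → Set
x ≡ y [mod M ] = (+ M) ∣ (x - y)

AdjRel : Set₁
AdjRel = ℤ → ℤ → Set

data Walk (M : ℕ) (Adj : AdjRel) : ℕ → ℤ → ℤ → Set where
  nil  : ∀ {u v} → u ≡ v [mod M ] → Walk M Adj zero u v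
  cons : ∀ {ℓ u w v} → Adj u w → Walk M Adj ℓ w v → Walk M Adj (suc ℓ) u v

vtx : {M : ℕ} → Fin M → ℤ
vtx i = + toℕ i

DistLe : (M : ℕ) → AdjRel → ℤ → ℤ → ℕ → Set
DistLe M Adj u v d = ∃[ ℓ ] (ℓ ≤ℕ d × Walk M Adj ℓ u v)

HasDiameter : (M : ℕ) → AdjRel → ℕ → Set
HasDiameter M Adj D =
  ((u v : Fin M) → DistLe M Adj (vtx u) (vtx v) D)
  × (∃[ u ] ∃[ v ] ((ℓ : ℕ) → ℓ <ℕ D → ¬ Walk M Adj ℓ (vtx {M} u) (vtx {M} v)))

DSGAdj : ℕ → ℤ → ℤ → AdjRel
DSGAdj N a b u w =
  (w ≡ u + a [mod N ]) ⊎ (w ≡ u - a [mod N ]) ⊎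
  (w ≡ u + b [mod N ]) ⊎ (w ≡ u - b [mod N ])

Even : ℤ → Set
Even x = (+ 2) ∣ x

NAAdj : ℕ → ℤ → ℤ → ℤ → ℤ → AdjRel
NAAdj M α β γ δ u w =
  (Even u × ((w ≡ u + α [mod M ]) ⊎ (w ≡ u + β [mod M ])))
  ⊎ (¬ Even u × ((w ≡ u + γ [mod M ]) ⊎ (w ≡ u + δ [mod M ])))

-- Two consecutive arcs of NA add α + γ = 2a, β + δ = -2a, β + γ = 2b or α + δ = -2b to a
-- vertex, and every arc changes its parity. Hence the walks of length 2m in NA are exactly the
-- walks of length m in G(2N; ±2a, ±2b), and p ↦ 2p + r maps the walks of G(N; ±a, ±b) onto
-- those of G(2N; ±2a, ±2b) inside the coset r + 2ℤ. Vertices of equal parity are thus at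
-- distance at most 2k, one extra arc repairs a parity mismatch, and the vertices 2x, 2y
-- coming from a diametral pair x, y of G are at distance exactly 2k.
module Submission where

open import Defs
open import Data.Nat using (ℕ; zero; suc; _≤_) renaming (_*_ to _*ℕ_)
open import Data.Nat.GCD using (gcd)
open import Data.Integer using (ℤ; +_; -[1+_]; _+_; _-_; -_; _*_; ∣_∣)
open import Data.Product using (∃-syntax; _×_; _,_)
open import Relation.Binary.PropositionalEquality using (_≡_; _≢_)

import Data.Nat as ℕ
import Data.Nat.Properties as ℕ
import Data.Nat.Divisibility as ℕ
import Data.Integer.Properties as ℤ
import Data.Integer.Divisibility.Signed as Signed
open import Data.Integer.DivMod using (_%ℕ_; _/ℕ_; a≡a%ℕn+[a/ℕn]*n; n%ℕd<d)
open import Data.Integer.Tactic.RingSolver using (solve-∀)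
open import Data.Fin using (Fin; toℕ; fromℕ<)
open import Data.Fin.Properties using (toℕ-fromℕ<; toℕ<n; all?; ¬∀⟶∃¬)
open import Data.Sum using (_⊎_; inj₁; inj₂)
open import Relation.Nullary using (¬_; Dec; yes; no; contradiction)
open import Relation.Nullary.Decidable using (map′; _⊎-dec_)
open import Relation.Binary.PropositionalEquality
  using (refl; sym; trans; cong; subst; subst₂; module ≡-Reasoning)

-- Congruences are handled through this record because x ≡ y [mod M ]
-- unfolds to a statement about ∣ x - y ∣, from which Agda cannot infer x and y.
infix 4 _≋_[mod_]
record _≋_[mod_] (x y : ℤ) (M : ℕ) : Set where
  constructor _,_
  field
    quotient : ℤ
    equation : x ≡ y + quotient * + M

≋⇒≡mod : ∀ {M x y} → x ≋ y [mod M ] → x ≡ y [mod M ]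
≋⇒≡mod {M} {y = y} (q , refl) = Signed.∣⇒∣ᵤ (Signed.divides q (cancel y q (+ M)))
  where
  cancel : ∀ y q m → (y + q * m) - y ≡ q * m
  cancel = solve-∀

≡mod⇒≋ : ∀ {M} x y → x ≡ y [mod M ] → x ≋ y [mod M ]
≡mod⇒≋ x y x≡y with Signed.∣ᵤ⇒∣ x≡y
... | Signed.divides q eq = q , trans (split x y) (cong (λ d → y + d) eq)
  where
  split : ∀ x y → x ≡ y + (x - y)
  split = solve-∀

≋-reflexive : ∀ {M x y} → x ≡ y → x ≋ y [mod M ]
≋-reflexive {M} {x} refl = + 0 , zero-multiple x (+ M)
  where
  zero-multiple : ∀ x m → x ≡ x + + 0 * m
  zero-multiple = solve-∀

≋-refl : ∀ {M x} → x ≋ x [mod M ]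
≋-refl = ≋-reflexive refl

≡mod-refl : ∀ {M} x → x ≡ x [mod M ]
≡mod-refl {M} x = ≋⇒≡mod (≋-refl {M} {x})

≋-sym : ∀ {M x y} → x ≋ y [mod M ] → y ≋ x [mod M ]
≋-sym {M} {y = y} (q , refl) = - q , undo y q (+ M)
  where
  undo : ∀ y q m → y ≡ (y + q * m) + (- q) * m
  undo = solve-∀

≋-trans : ∀ {M x y z} → x ≋ y [mod M ] → y ≋ z [mod M ] → x ≋ z [mod M ]
≋-trans {M} {z = z} (q , refl) (p , refl) = p + q , collect z p q (+ M)
  where
  collect : ∀ z p q m → (z + p * m) + q * m ≡ z + (p + q) * m
  collect = solve-∀

≋-+ʳ : ∀ {M x y} s → x ≋ y [mod M ] → x + s ≋ y + s [mod M ]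
≋-+ʳ {M} {y = y} s (q , refl) = q , shuffle y q (+ M) s
  where
  shuffle : ∀ y q m s → y + q * m + s ≡ y + s + q * m
  shuffle = solve-∀

≋-+ˡ : ∀ {M x y} s → x ≋ y [mod M ] → s + x ≋ s + y [mod M ]
≋-+ˡ {x = x} {y} s x≋y =
  ≋-trans (≋-reflexive (ℤ.+-comm s x)) (≋-trans (≋-+ʳ s x≋y) (≋-reflexive (ℤ.+-comm y s)))

≋-complement : ∀ {M x y} → x + y ≋ + 0 [mod M ] → y ≋ - x [mod M ]
≋-complement {x = x} {y} x+y≋0 =
  ≋-trans (≋-reflexive (re-add x y))
          (≋-trans (≋-+ʳ (- x) x+y≋0) (≋-reflexive (ℤ.+-identityˡ (- x))))
  where
  re-add : ∀ x y → y ≡ x + y - x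
  re-add = solve-∀

≋-compose : ∀ {M w v s} u s₁ s₂ → w ≋ u + s₁ [mod M ] → v ≋ w + s₂ [mod M ] →
            s₁ + s₂ ≋ s [mod M ] → v ≋ u + s [mod M ]
≋-compose u s₁ s₂ w≋ v≋ s₁+s₂≋s =
  ≋-trans v≋ (≋-trans (≋-+ʳ s₂ w≋) (≋-trans (≋-reflexive (ℤ.+-assoc u s₁ s₂)) (≋-+ˡ u s₁+s₂≋s)))

≋-decompose : ∀ {M v s} u s₁ s₂ → v ≋ u + s [mod M ] → s₁ + s₂ ≋ s [mod M ] →
              v ≋ u + s₁ + s₂ [mod M ]
≋-decompose u s₁ s₂ v≋ s₁+s₂≋s =
  ≋-trans v≋ (≋-trans (≋-+ˡ u (≋-sym s₁+s₂≋s)) (≋-reflexive (sym (ℤ.+-assoc u s₁ s₂))))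

≋-affine : ∀ {N x y} c r → x ≋ y [mod N ] → + c * x + r ≋ + c * y + r [mod c *ℕ N ]
≋-affine {N} {y = y} c r (q , refl) =
  q , trans (expand (+ c) y q (+ N) r) (cong (λ m → + c * y + r + q * m) (sym (ℤ.pos-* c N)))
  where
  expand : ∀ c y q n r → c * (y + q * n) + r ≡ c * y + r + q * (c * n)
  expand = solve-∀

≋-affine⁻¹ : ∀ {N x y} c r .{{_ : ℕ.NonZero c}} →
             + c * x + r ≋ + c * y + r [mod c *ℕ N ] → x ≋ y [mod N ]
≋-affine⁻¹ {N} {x} {y} c r (q , eq) = q , ℤ.*-cancelˡ-≡ (+ c) x (y + q * + N) (begin
  + c * x                             ≡⟨ isolate (+ c) x r ⟩
  (+ c * x + r) - r                   ≡⟨ cong (_- r) eq ⟩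
  (+ c * y + r + q * + (c *ℕ N)) - r  ≡⟨ cong (λ m → (+ c * y + r + q * m) - r) (ℤ.pos-* c N) ⟩
  (+ c * y + r + q * (+ c * + N)) - r ≡⟨ factor (+ c) y r q (+ N) ⟩
  + c * (y + q * + N)                 ∎)
  where
  open ≡-Reasoning
  isolate : ∀ c x r → c * x ≡ (c * x + r) - r
  isolate = solve-∀
  factor : ∀ c y r q n → (c * y + r + q * (c * n)) - r ≡ c * (y + q * n)
  factor = solve-∀

≋-vtx : ∀ {N} .{{_ : ℕ.NonZero N}} x → ∃[ i ] (x ≋ vtx {N} i [mod N ])
≋-vtx {N} x = fromℕ< x%N<N , x /ℕ N ,
  trans (a≡a%ℕn+[a/ℕn]*n x N) (cong (λ i → + i + (x /ℕ N) * + N) (sym (toℕ-fromℕ< x%N<N)))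
  where
  x%N<N = n%ℕd<d x N

Even? : ∀ x → Dec (Even x)
Even? x = 2 ℕ.∣? ∣ x ∣

Even⇒2∣ : ∀ x → Even x → + 2 Signed.∣ x
Even⇒2∣ x = Signed.∣ᵤ⇒∣ {+ 2} {x}

2∣⇒Even : ∀ {x} → + 2 Signed.∣ x → Even x
2∣⇒Even = Signed.∣⇒∣ᵤ

even-2* : ∀ t → Even (+ 2 * t)
even-2* t = 2∣⇒Even (Signed.divides t (ℤ.*-comm (+ 2) t))

odd-2*+1 : ∀ t → ¬ Even (+ 2 * t + + 1)
odd-2*+1 t 2t+1-even =
  2∤1 (Signed.∣m+n∣m⇒∣n (Even⇒2∣ (+ 2 * t + + 1) 2t+1-even) (Even⇒2∣ (+ 2 * t) (even-2* t)))
  where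
  2∤1 : ¬ (+ 2 Signed.∣ + 1)
  2∤1 2∣1 with ℕ.∣1⇒≡1 (Signed.∣⇒∣ᵤ 2∣1)
  ... | ()

even-or-odd : ∀ x → ∃[ t ] (x ≡ + 2 * t) ⊎ ∃[ t ] (x ≡ + 2 * t + + 1)
even-or-odd x with x %ℕ 2 | n%ℕd<d x 2 | a≡a%ℕn+[a/ℕn]*n x 2
... | 0 | _ | x≡ = inj₁ (x /ℕ 2 , trans x≡ (even-form (x /ℕ 2)))
  where
  even-form : ∀ t → + 0 + t * + 2 ≡ + 2 * t
  even-form = solve-∀
... | 1 | _ | x≡ = inj₂ (x /ℕ 2 , trans x≡ (odd-form (x /ℕ 2)))
  where
  odd-form : ∀ t → + 1 + t * + 2 ≡ + 2 * t + + 1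
  odd-form = solve-∀
... | suc (suc _) | ℕ.s≤s (ℕ.s≤s ()) | _

odd⇒2*+1 : ∀ x → ¬ Even x → ∃[ t ] (x ≡ + 2 * t + + 1)
odd⇒2*+1 x x-odd with even-or-odd x
... | inj₁ (t , refl) = contradiction (even-2* t) x-odd
... | inj₂ t,x≡2t+1   = t,x≡2t+1

even+odd : ∀ x s → Even x → ¬ Even s → ¬ Even (x + s)
even+odd x s x-even s-odd x+s-even =
  s-odd (2∣⇒Even (Signed.∣m+n∣m⇒∣n (Even⇒2∣ (x + s) x+s-even) (Even⇒2∣ x x-even)))

odd+odd : ∀ x s → ¬ Even x → ¬ Even s → Even (x + s)
odd+odd x s x-odd s-odd with odd⇒2*+1 x x-odd | odd⇒2*+1 s s-odd
... | t , refl | t′ , refl = subst Even (sum-form t t′) (even-2* (t + t′ + + 1))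
  where
  sum-form : ∀ t t′ → + 2 * (t + t′ + + 1) ≡ (+ 2 * t + + 1) + (+ 2 * t′ + + 1)
  sum-form = solve-∀

even-≋ : ∀ {M x y} → 2 ℕ.∣ M → x ≋ y [mod M ] → Even y → Even x
even-≋ {M} {y = y} 2∣M (q , refl) y-even = 2∣⇒Even
  (Signed.∣m∣n⇒∣m+n (Even⇒2∣ y y-even) (Signed.∣n⇒∣m*n q (Signed.∣ᵤ⇒∣ {+ 2} {+ M} 2∣M)))

odd-≋ : ∀ {M x y} → 2 ℕ.∣ M → x ≋ y [mod M ] → ¬ Even y → ¬ Even x
odd-≋ 2∣M x≋y y-odd x-even = y-odd (even-≋ 2∣M (≋-sym x≋y) x-even)

walk-map : ∀ {M A B ℓ u v} → (∀ x y → A x y → B x y) → Walk M A ℓ u v → Walk M B ℓ u v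
walk-map f (nil u≡v)                = nil u≡v
walk-map f (cons {u = u} {w} a as) = cons (f u w a) (walk-map f as)

walk-≋-end : ∀ {M A ℓ u v v′} → Walk M A ℓ u v → v ≋ v′ [mod M ] → Walk M A ℓ u v′
walk-≋-end {u = u} {v} (nil u≡v)   v≋v′ = nil (≋⇒≡mod (≋-trans (≡mod⇒≋ u v u≡v) v≋v′))
walk-≋-end             (cons a as) v≋v′ = cons a (walk-≋-end as v≋v′)

walk-≋-start : ∀ {M A ℓ u u′ v} → (∀ x x′ y → x′ ≋ x [mod M ] → A x y → A x′ y) →
               u′ ≋ u [mod M ] → Walk M A ℓ u v → Walk M A ℓ u′ v
walk-≋-start {u = u} {v = v} A-resp u′≋u (nil u≡v) = nil (≋⇒≡mod (≋-trans u′≋u (≡mod⇒≋ u v u≡v)))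
walk-≋-start {u = u} {u′} A-resp u′≋u (cons {w = w} a as) = cons (A-resp u u′ w u′≋u a) as

infix 10 _²
_² : AdjRel → AdjRel
(A ²) u v = ∃[ w ] (A u w × A w v)

-- Unlike 2 *ℕ m, this reduces to suc (suc …), the shape of a walk that takes two arcs at a time.
double : ℕ → ℕ
double zero    = zero
double (suc m) = suc (suc (double m))

double≡2* : ∀ m → double m ≡ 2 *ℕ m
double≡2* zero    = refl
double≡2* (suc m) = trans (cong (λ n → suc (suc n)) (double≡2* m)) (sym (ℕ.*-suc 2 m))

double-or-suc-double : ∀ ℓ → ∃[ m ] (ℓ ≡ double m ⊎ ℓ ≡ suc (double m))
double-or-suc-double zero    = zero , inj₁ refl
double-or-suc-double (suc ℓ) with double-or-suc-double ℓ
... | m , inj₁ refl = m , inj₂ refl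
... | m , inj₂ refl = suc m , inj₁ refl

walk-²⇒ : ∀ {M A m u v} → Walk M (A ²) m u v → Walk M A (double m) u v
walk-²⇒ (nil u≡v)                = nil u≡v
walk-²⇒ (cons (_ , a , a′) as)   = cons a (cons a′ (walk-²⇒ as))

walk-⇒² : ∀ {M A u v} m → Walk M A (double m) u v → Walk M (A ²) m u v
walk-⇒² zero    (nil u≡v)              = nil u≡v
walk-⇒² (suc m) (cons a (cons a′ as)) = cons (_ , a , a′) (walk-⇒² m as)

DistGe : (M : ℕ) → AdjRel → ℤ → ℤ → ℕ → Set
DistGe M A u v d = ∀ ℓ → ℓ ℕ.< d → ¬ Walk M A ℓ u v

dist? : ∀ {M A} → (∀ ℓ u v → Dec (Walk M A ℓ u v)) → ∀ d u v → Dec (DistLe M A u v d)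
dist? walk? d u v = map′ (λ (ℓ , ℓ<1+d , w) → ℓ , ℕ.s≤s⁻¹ ℓ<1+d , w)
                         (λ (ℓ , ℓ≤d , w) → ℓ , ℕ.s≤s ℓ≤d , w)
                         (ℕ.anyUpTo? (λ ℓ → walk? ℓ u v) (suc d))

diameter-between : ∀ {M A} d → (∀ ℓ u v → Dec (Walk M A ℓ u v)) →
                   (∀ (u v : Fin M) → DistLe M A (vtx u) (vtx v) (suc d)) →
                   ∃[ u ] ∃[ v ] DistGe M A (vtx {M} u) (vtx {M} v) d →
                   ∃[ D ] (HasDiameter M A D × d ≤ D × D ≤ suc d)
diameter-between {M} d walk? within-1+d far
  with all? (λ u → all? (λ v → dist? walk? d (vtx u) (vtx v)))
... | yes within-d = d , (within-d , far) , ℕ.≤-refl , ℕ.n≤1+n d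
... | no ¬within-d with ¬∀⟶∃¬ M _ (λ u → all? (λ v → dist? walk? d (vtx u) (vtx v))) ¬within-d
... | u , ¬within-d-from-u with ¬∀⟶∃¬ M _ (λ v → dist? walk? d (vtx u) (vtx v)) ¬within-d-from-u
... | v , u-v-far =
  suc d , (within-1+d , u , v , λ ℓ ℓ<1+d w → u-v-far (ℓ , ℕ.s≤s⁻¹ ℓ<1+d , w)) ,
  ℕ.n≤1+n d , ℕ.≤-refl

double-fin : ∀ {N} → Fin N → Fin (2 *ℕ N)
double-fin x = fromℕ< (ℕ.*-monoʳ-< 2 (toℕ<n x))

vtx-double-fin : ∀ {N} (x : Fin N) → vtx (double-fin x) ≡ + 2 * vtx x
vtx-double-fin x = trans (cong +_ (toℕ-fromℕ< (ℕ.*-monoʳ-< 2 (toℕ<n x)))) (ℤ.pos-* 2 (toℕ x))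

module _ {N : ℕ} {a b : ℤ} (c : ℕ) (r : ℤ) where

  private
    M = c *ℕ N

    φ : ℤ → ℤ
    φ p = + c * p + r

    ≋-shift : ∀ {u p} s {s′} → s′ ≡ + c * s → u ≋ φ p [mod M ] → u + s′ ≋ φ (p + s) [mod M ]
    ≋-shift {u} {p} s refl u≋φp = ≋-trans (≋-+ʳ (+ c * s) u≋φp) (≋-reflexive (regroup (+ c) p r s))
      where
      regroup : ∀ c p r s → c * p + r + c * s ≡ c * (p + s) + r
      regroup = solve-∀

    ≋-step : ∀ {u p} p′ s {s′} → s′ ≡ + c * s → p′ ≡ p + s [mod N ] → u ≋ φ p [mod M ] →
             u + s′ ≋ φ p′ [mod M ]
    ≋-step p′ s s′≡cs p′≡ u≋ = ≋-trans (≋-shift s s′≡cs u≋) (≋-affine c r (≋-sym (≡mod⇒≋ p′ _ p′≡)))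

    arc-lift : ∀ {u} p p′ → DSGAdj N a b p p′ → u ≋ φ p [mod M ] →
               ∃[ w ] (DSGAdj M (+ c * a) (+ c * b) u w × w ≋ φ p′ [mod M ])
    arc-lift {u} p p′ (inj₁ p′≡) u≋ =
      u + + c * a , inj₁ (≡mod-refl (u + + c * a)) ,
      ≋-step p′ a refl p′≡ u≋
    arc-lift {u} p p′ (inj₂ (inj₁ p′≡)) u≋ =
      u - + c * a , inj₂ (inj₁ (≡mod-refl (u - + c * a))) ,
      ≋-step p′ (- a) (ℤ.neg-distribʳ-* (+ c) a) p′≡ u≋
    arc-lift {u} p p′ (inj₂ (inj₂ (inj₁ p′≡))) u≋ =
      u + + c * b , inj₂ (inj₂ (inj₁ (≡mod-refl (u + + c * b)))) ,
      ≋-step p′ b refl p′≡ u≋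
    arc-lift {u} p p′ (inj₂ (inj₂ (inj₂ p′≡))) u≋ =
      u - + c * b , inj₂ (inj₂ (inj₂ (≡mod-refl (u - + c * b)))) ,
      ≋-step p′ (- b) (ℤ.neg-distribʳ-* (+ c) b) p′≡ u≋

    arc-project : ∀ {p} u w → DSGAdj M (+ c * a) (+ c * b) u w → u ≋ φ p [mod M ] →
                  ∃[ p′ ] (DSGAdj N a b p p′ × w ≋ φ p′ [mod M ])
    arc-project {p} u w (inj₁ w≡) u≋ =
      p + a , inj₁ (≡mod-refl (p + a)) ,
      ≋-trans (≡mod⇒≋ w _ w≡) (≋-shift a refl u≋)
    arc-project {p} u w (inj₂ (inj₁ w≡)) u≋ =
      p - a , inj₂ (inj₁ (≡mod-refl (p - a))) ,
      ≋-trans (≡mod⇒≋ w _ w≡) (≋-shift (- a) (ℤ.neg-distribʳ-* (+ c) a) u≋)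
    arc-project {p} u w (inj₂ (inj₂ (inj₁ w≡))) u≋ =
      p + b , inj₂ (inj₂ (inj₁ (≡mod-refl (p + b)))) ,
      ≋-trans (≡mod⇒≋ w _ w≡) (≋-shift b refl u≋)
    arc-project {p} u w (inj₂ (inj₂ (inj₂ w≡))) u≋ =
      p - b , inj₂ (inj₂ (inj₂ (≡mod-refl (p - b)))) ,
      ≋-trans (≡mod⇒≋ w _ w≡) (≋-shift (- b) (ℤ.neg-distribʳ-* (+ c) b) u≋)

  DSG-walk-lift : ∀ {m p q u v} → Walk N (DSGAdj N a b) m p q →
                  u ≋ φ p [mod M ] → v ≋ φ q [mod M ] → Walk M (DSGAdj M (+ c * a) (+ c * b)) m u v
  DSG-walk-lift {p = p} {q} (nil p≡q) u≋ v≋ =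
    nil (≋⇒≡mod (≋-trans u≋ (≋-trans (≋-affine c r (≡mod⇒≋ p q p≡q)) (≋-sym v≋))))
  DSG-walk-lift {p = p} (cons {w = p′} arc rest) u≋ v≋ with arc-lift p p′ arc u≋
  ... | _ , arc′ , w≋ = cons arc′ (DSG-walk-lift rest w≋ v≋)

  DSG-walk-project : ∀ {m p u v} → Walk M (DSGAdj M (+ c * a) (+ c * b)) m u v →
                     u ≋ φ p [mod M ] → ∃[ q ] (v ≋ φ q [mod M ] × Walk N (DSGAdj N a b) m p q)
  DSG-walk-project {p = p} {u} {v} (nil u≡v) u≋ =
    p , ≋-trans (≋-sym (≡mod⇒≋ u v u≡v)) u≋ , nil (≡mod-refl p)
  DSG-walk-project {u = u} (cons {w = w} arc′ rest) u≋ with arc-project u w arc′ u≋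
  ... | _ , arc , w≋ with DSG-walk-project rest w≋
  ...   | q , v≋ , walk = q , v≋ , cons arc walk

module _ (n : ℕ) (α β γ δ : ℤ) where

  private
    M = 2 *ℕ n
    NA = NAAdj M α β γ δ

    2∣M : 2 ℕ.∣ M
    2∣M = ℕ.m∣m*n n

  α-arc : ∀ u {w} → Even u → w ≋ u + α [mod M ] → NA u w
  α-arc u u-even w≋ = inj₁ (u-even , inj₁ (≋⇒≡mod w≋))

  β-arc : ∀ u {w} → Even u → w ≋ u + β [mod M ] → NA u w
  β-arc u u-even w≋ = inj₁ (u-even , inj₂ (≋⇒≡mod w≋))

  γ-arc : ∀ u {w} → ¬ Even u → w ≋ u + γ [mod M ] → NA u w
  γ-arc u u-odd w≋ = inj₂ (u-odd , inj₁ (≋⇒≡mod w≋))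

  δ-arc : ∀ u {w} → ¬ Even u → w ≋ u + δ [mod M ] → NA u w
  δ-arc u u-odd w≋ = inj₂ (u-odd , inj₂ (≋⇒≡mod w≋))

  NA-view : ∀ u w → NA u w →
            (Even u × (w ≋ u + α [mod M ] ⊎ w ≋ u + β [mod M ])) ⊎
            (¬ Even u × (w ≋ u + γ [mod M ] ⊎ w ≋ u + δ [mod M ]))
  NA-view u w (inj₁ (u-even , inj₁ w≡)) = inj₁ (u-even , inj₁ (≡mod⇒≋ w _ w≡))
  NA-view u w (inj₁ (u-even , inj₂ w≡)) = inj₁ (u-even , inj₂ (≡mod⇒≋ w _ w≡))
  NA-view u w (inj₂ (u-odd , inj₁ w≡))  = inj₂ (u-odd , inj₁ (≡mod⇒≋ w _ w≡))
  NA-view u w (inj₂ (u-odd , inj₂ w≡))  = inj₂ (u-odd , inj₂ (≡mod⇒≋ w _ w≡))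

  NA-≋-source : ∀ x x′ y → x′ ≋ x [mod M ] → NA x y → NA x′ y
  NA-≋-source x x′ y x′≋x arc with NA-view x y arc | ≋-sym x′≋x
  ... | inj₁ (x-even , inj₁ y≋) | x≋x′ = α-arc x′ (even-≋ 2∣M x′≋x x-even) (≋-trans y≋ (≋-+ʳ α x≋x′))
  ... | inj₁ (x-even , inj₂ y≋) | x≋x′ = β-arc x′ (even-≋ 2∣M x′≋x x-even) (≋-trans y≋ (≋-+ʳ β x≋x′))
  ... | inj₂ (x-odd , inj₁ y≋)  | x≋x′ = γ-arc x′ (odd-≋ 2∣M x′≋x x-odd) (≋-trans y≋ (≋-+ʳ γ x≋x′))
  ... | inj₂ (x-odd , inj₂ y≋)  | x≋x′ = δ-arc x′ (odd-≋ 2∣M x′≋x x-odd) (≋-trans y≋ (≋-+ʳ δ x≋x′))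

  NA-walk? : ∀ ℓ u v → Dec (Walk M NA ℓ u v)
  NA-walk? zero    u v = map′ nil (λ { (nil u≡v) → u≡v }) (M ℕ.∣? ∣ u - v ∣)
  NA-walk? (suc ℓ) u v with Even? u
  ... | yes u-even = map′
    (λ { (inj₁ w) → cons (α-arc u u-even ≋-refl) w ; (inj₂ w) → cons (β-arc u u-even ≋-refl) w })
    (λ { (cons {w = w} arc rest) → first-arc w arc rest })
    (NA-walk? ℓ (u + α) v ⊎-dec NA-walk? ℓ (u + β) v)
    where
    first-arc : ∀ w → NA u w → Walk M NA ℓ w v → Walk M NA ℓ (u + α) v ⊎ Walk M NA ℓ (u + β) v
    first-arc w arc rest with NA-view u w arc
    ... | inj₁ (_ , inj₁ w≋) = inj₁ (walk-≋-start NA-≋-source (≋-sym w≋) rest)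
    ... | inj₁ (_ , inj₂ w≋) = inj₂ (walk-≋-start NA-≋-source (≋-sym w≋) rest)
    ... | inj₂ (u-odd , _)   = contradiction u-even u-odd
  ... | no u-odd = map′
    (λ { (inj₁ w) → cons (γ-arc u u-odd ≋-refl) w ; (inj₂ w) → cons (δ-arc u u-odd ≋-refl) w })
    (λ { (cons {w = w} arc rest) → first-arc w arc rest })
    (NA-walk? ℓ (u + γ) v ⊎-dec NA-walk? ℓ (u + δ) v)
    where
    first-arc : ∀ w → NA u w → Walk M NA ℓ w v → Walk M NA ℓ (u + γ) v ⊎ Walk M NA ℓ (u + δ) v
    first-arc w arc rest with NA-view u w arc
    ... | inj₁ (u-even , _)  = contradiction u-even u-odd
    ... | inj₂ (_ , inj₁ w≋) = inj₁ (walk-≋-start NA-≋-source (≋-sym w≋) rest)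
    ... | inj₂ (_ , inj₂ w≋) = inj₂ (walk-≋-start NA-≋-source (≋-sym w≋) rest)

  arc-from-even : ¬ Even α → ¬ Even β → ∀ u w → Even u → NA u w → ¬ Even w
  arc-from-even α-odd β-odd u w u-even arc with NA-view u w arc
  ... | inj₁ (_ , inj₁ w≋) = odd-≋ 2∣M w≋ (even+odd u α u-even α-odd)
  ... | inj₁ (_ , inj₂ w≋) = odd-≋ 2∣M w≋ (even+odd u β u-even β-odd)
  ... | inj₂ (u-odd , _)   = contradiction u-even u-odd

  arc-from-odd : ¬ Even γ → ¬ Even δ → ∀ u w → ¬ Even u → NA u w → Even w
  arc-from-odd γ-odd δ-odd u w u-odd arc with NA-view u w arc
  ... | inj₁ (u-even , _)  = contradiction u-even u-odd
  ... | inj₂ (_ , inj₁ w≋) = even-≋ 2∣M w≋ (odd+odd u γ u-odd γ-odd)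
  ... | inj₂ (_ , inj₂ w≋) = even-≋ 2∣M w≋ (odd+odd u δ u-odd δ-odd)

  module _ (α-odd : ¬ Even α) (β-odd : ¬ Even β) (γ-odd : ¬ Even γ) (δ-odd : ¬ Even δ)
           (steps-sum : (α + β + γ + δ) ≡ + 0 [mod M ]) where

    private
      regroupᴬ : ∀ α β γ δ → (α + γ) + (β + δ) ≡ α + β + γ + δ
      regroupᴬ = solve-∀

      regroupᴮ : ∀ α β γ δ → (β + γ) + (α + δ) ≡ α + β + γ + δ
      regroupᴮ = solve-∀

      βδ≋-A : β + δ ≋ - (α + γ) [mod M ]
      βδ≋-A = ≋-complement (≋-trans (≋-reflexive (regroupᴬ α β γ δ)) (≡mod⇒≋ _ (+ 0) steps-sum))

      αδ≋-B : α + δ ≋ - (β + γ) [mod M ]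
      αδ≋-B = ≋-complement (≋-trans (≋-reflexive (regroupᴮ α β γ δ)) (≡mod⇒≋ _ (+ 0) steps-sum))

      γα≋A : γ + α ≋ α + γ [mod M ]
      γα≋A = ≋-reflexive (ℤ.+-comm γ α)

      γβ≋B : γ + β ≋ β + γ [mod M ]
      γβ≋B = ≋-reflexive (ℤ.+-comm γ β)

      δβ≋-A : δ + β ≋ - (α + γ) [mod M ]
      δβ≋-A = ≋-trans (≋-reflexive (ℤ.+-comm δ β)) βδ≋-A

      δα≋-B : δ + α ≋ - (β + γ) [mod M ]
      δα≋-B = ≋-trans (≋-reflexive (ℤ.+-comm δ α)) αδ≋-B

    NA²⇒DSG : ∀ u v → (NA ²) u v → DSGAdj M (α + γ) (β + γ) u v
    NA²⇒DSG u v (w , arc₁ , arc₂) with NA-view u w arc₁ | NA-view w v arc₂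
    ... | inj₁ (u-even , _) | inj₁ (w-even , _) =
      contradiction w-even (arc-from-even α-odd β-odd u w u-even arc₁)
    ... | inj₂ (u-odd , _) | inj₂ (w-odd , _) =
      contradiction (arc-from-odd γ-odd δ-odd u w u-odd arc₁) w-odd
    ... | inj₁ (_ , inj₁ w≋) | inj₂ (_ , inj₁ v≋) = inj₁ (≋⇒≡mod (≋-compose u α γ w≋ v≋ ≋-refl))
    ... | inj₁ (_ , inj₂ w≋) | inj₂ (_ , inj₂ v≋) =
      inj₂ (inj₁ (≋⇒≡mod (≋-compose u β δ w≋ v≋ βδ≋-A)))
    ... | inj₁ (_ , inj₂ w≋) | inj₂ (_ , inj₁ v≋) =
      inj₂ (inj₂ (inj₁ (≋⇒≡mod (≋-compose u β γ w≋ v≋ ≋-refl))))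
    ... | inj₁ (_ , inj₁ w≋) | inj₂ (_ , inj₂ v≋) =
      inj₂ (inj₂ (inj₂ (≋⇒≡mod (≋-compose u α δ w≋ v≋ αδ≋-B))))
    ... | inj₂ (_ , inj₁ w≋) | inj₁ (_ , inj₁ v≋) = inj₁ (≋⇒≡mod (≋-compose u γ α w≋ v≋ γα≋A))
    ... | inj₂ (_ , inj₂ w≋) | inj₁ (_ , inj₂ v≋) =
      inj₂ (inj₁ (≋⇒≡mod (≋-compose u δ β w≋ v≋ δβ≋-A)))
    ... | inj₂ (_ , inj₁ w≋) | inj₁ (_ , inj₂ v≋) =
      inj₂ (inj₂ (inj₁ (≋⇒≡mod (≋-compose u γ β w≋ v≋ γβ≋B))))
    ... | inj₂ (_ , inj₂ w≋) | inj₁ (_ , inj₁ v≋) =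
      inj₂ (inj₂ (inj₂ (≋⇒≡mod (≋-compose u δ α w≋ v≋ δα≋-B))))

    DSG⇒NA² : ∀ u v → DSGAdj M (α + γ) (β + γ) u v → (NA ²) u v
    DSG⇒NA² u v arc with Even? u
    ... | yes u-even = from-even arc
      where
      u+α-odd = even+odd u α u-even α-odd
      u+β-odd = even+odd u β u-even β-odd

      from-even : DSGAdj M (α + γ) (β + γ) u v → (NA ²) u v
      from-even (inj₁ v≡) = u + α , α-arc u u-even ≋-refl ,
        γ-arc (u + α) u+α-odd (≋-decompose u α γ (≡mod⇒≋ v _ v≡) ≋-refl)
      from-even (inj₂ (inj₁ v≡)) = u + β , β-arc u u-even ≋-refl ,
        δ-arc (u + β) u+β-odd (≋-decompose u β δ (≡mod⇒≋ v _ v≡) βδ≋-A)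
      from-even (inj₂ (inj₂ (inj₁ v≡))) = u + β , β-arc u u-even ≋-refl ,
        γ-arc (u + β) u+β-odd (≋-decompose u β γ (≡mod⇒≋ v _ v≡) ≋-refl)
      from-even (inj₂ (inj₂ (inj₂ v≡))) = u + α , α-arc u u-even ≋-refl ,
        δ-arc (u + α) u+α-odd (≋-decompose u α δ (≡mod⇒≋ v _ v≡) αδ≋-B)
    ... | no u-odd = from-odd arc
      where
      u+γ-even = odd+odd u γ u-odd γ-odd
      u+δ-even = odd+odd u δ u-odd δ-odd

      from-odd : DSGAdj M (α + γ) (β + γ) u v → (NA ²) u v
      from-odd (inj₁ v≡) = u + γ , γ-arc u u-odd ≋-refl ,
        α-arc (u + γ) u+γ-even (≋-decompose u γ α (≡mod⇒≋ v _ v≡) γα≋A)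
      from-odd (inj₂ (inj₁ v≡)) = u + δ , δ-arc u u-odd ≋-refl ,
        β-arc (u + δ) u+δ-even (≋-decompose u δ β (≡mod⇒≋ v _ v≡) δβ≋-A)
      from-odd (inj₂ (inj₂ (inj₁ v≡))) = u + γ , γ-arc u u-odd ≋-refl ,
        β-arc (u + γ) u+γ-even (≋-decompose u γ β (≡mod⇒≋ v _ v≡) γβ≋B)
      from-odd (inj₂ (inj₂ (inj₂ v≡))) = u + δ , δ-arc u u-odd ≋-refl ,
        α-arc (u + δ) u+δ-even (≋-decompose u δ α (≡mod⇒≋ v _ v≡) δα≋-B)

module _ (N : ℕ) .{{_ : ℕ.NonZero N}} (a b : ℤ) where

  private
    M = 2 *ℕ N
    α = -[1+ 0 ]
    β = + 2 * (b - a) - + 1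
    γ = + 2 * a + + 1
    δ = - (+ 2 * b) + + 1
    2∣M : 2 ℕ.∣ M
    2∣M = ℕ.m∣m*n N
    G  = DSGAdj N a b
    G′ = DSGAdj M (+ 2 * a) (+ 2 * b)
    NA = NAAdj M α β γ δ

    α-odd : ¬ Even α
    α-odd = odd-2*+1 (- + 1)
    β-odd : ¬ Even β
    β-odd = subst (λ s → ¬ Even s) (β-form a b) (odd-2*+1 (b - a - + 1))
      where
      β-form : ∀ a b → + 2 * (b - a - + 1) + + 1 ≡ + 2 * (b - a) - + 1
      β-form = solve-∀
    γ-odd : ¬ Even γ
    γ-odd = odd-2*+1 a
    δ-odd : ¬ Even δ
    δ-odd = subst (λ s → ¬ Even s) (δ-form b) (odd-2*+1 (- b))
      where
      δ-form : ∀ b → + 2 * (- b) + + 1 ≡ - (+ 2 * b) + + 1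
      δ-form = solve-∀
    steps-sum : (α + β + γ + δ) ≡ + 0 [mod M ]
    steps-sum = ≋⇒≡mod (≋-reflexive (sum-form a b))
      where
      sum-form : ∀ a b →
        -[1+ 0 ] + (+ 2 * (b - a) - + 1) + (+ 2 * a + + 1) + (- (+ 2 * b) + + 1) ≡ + 0
      sum-form = solve-∀

    α+γ≡2a : α + γ ≡ + 2 * a
    α+γ≡2a = A-form a
      where
      A-form : ∀ a → -[1+ 0 ] + (+ 2 * a + + 1) ≡ + 2 * a
      A-form = solve-∀
    β+γ≡2b : β + γ ≡ + 2 * b
    β+γ≡2b = B-form a b
      where
      B-form : ∀ a b → (+ 2 * (b - a) - + 1) + (+ 2 * a + + 1) ≡ + 2 * b
      B-form = solve-∀

    G′⇒NA² : ∀ u v → G′ u v → (NA ²) u v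
    G′⇒NA² u v arc = DSG⇒NA² N α β γ δ α-odd β-odd γ-odd δ-odd steps-sum u v
      (subst₂ (λ A B → DSGAdj M A B u v) (sym α+γ≡2a) (sym β+γ≡2b) arc)

    NA²⇒G′ : ∀ u v → (NA ²) u v → G′ u v
    NA²⇒G′ u v arc = subst₂ (λ A B → DSGAdj M A B u v) α+γ≡2a β+γ≡2b
      (NA²⇒DSG N α β γ δ α-odd β-odd γ-odd δ-odd steps-sum u v arc)

    gap-after-α : ∀ u v t → v - u ≡ + 2 * t + + 1 → v - (u + α) ≡ + 2 * (t + + 1)
    gap-after-α u v t eq = trans (regroup u v) (trans (cong (_+ + 1) eq) (collect t))
      where
      regroup : ∀ u v → v - (u + -[1+ 0 ]) ≡ (v - u) + + 1
      regroup = solve-∀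
      collect : ∀ t → + 2 * t + + 1 + + 1 ≡ + 2 * (t + + 1)
      collect = solve-∀

    gap-after-γ : ∀ u v t → v - u ≡ + 2 * t + + 1 → v - (u + γ) ≡ + 2 * (t - a)
    gap-after-γ u v t eq = trans (regroup u v a) (trans (cong (_- γ) eq) (collect t a))
      where
      regroup : ∀ u v a → v - (u + (+ 2 * a + + 1)) ≡ (v - u) - (+ 2 * a + + 1)
      regroup = solve-∀
      collect : ∀ t a → + 2 * t + + 1 - (+ 2 * a + + 1) ≡ + 2 * (t - a)
      collect = solve-∀

  module _ {k : ℕ} (G-within : ∀ (i j : Fin N) → DistLe N G (vtx i) (vtx j) k) where

    NA-within-even-gap : ∀ u v t → v - u ≡ + 2 * t → DistLe M NA u v (2 *ℕ k)
    -- A walk of G from (a representative of) 0 to t, moved by p ↦ 2p + u.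
    NA-within-even-gap u v t v-u≡2t with ≋-vtx {N} (+ 0) | ≋-vtx {N} t
    ... | i , 0≋i | j , t≋j with G-within i j
    ... | m , m≤k , walk = double m ,
      subst (ℕ._≤ 2 *ℕ k) (sym (double≡2* m)) (ℕ.*-monoʳ-≤ 2 m≤k) ,
      walk-²⇒ (walk-map G′⇒NA² (DSG-walk-lift 2 u walk
        (≋-trans (≋-reflexive (sym (ℤ.+-identityˡ u))) (≋-affine 2 u 0≋i))
        (≋-trans (≋-reflexive (trans (split u v) (cong (_+ u) v-u≡2t))) (≋-affine 2 u t≋j))))
      where
      split : ∀ u v → v ≡ (v - u) + u
      split = solve-∀

    NA-within : ∀ u v → DistLe M NA u v (suc (2 *ℕ k))
    NA-within u v with even-or-odd (v - u) | Even? u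
    ... | inj₁ (t , v-u≡2t) | _ with NA-within-even-gap u v t v-u≡2t
    ...   | ℓ , ℓ≤2k , walk = ℓ , ℕ.m≤n⇒m≤1+n ℓ≤2k , walk
    NA-within u v | inj₂ (t , v-u≡2t+1) | yes u-even
      with NA-within-even-gap (u + α) v (t + + 1) (gap-after-α u v t v-u≡2t+1)
    ... | ℓ , ℓ≤2k , walk = suc ℓ , ℕ.s≤s ℓ≤2k , cons (α-arc N α β γ δ u u-even ≋-refl) walk
    NA-within u v | inj₂ (t , v-u≡2t+1) | no u-odd
      with NA-within-even-gap (u + γ) v (t - a) (gap-after-γ u v t v-u≡2t+1)
    ... | ℓ , ℓ≤2k , walk = suc ℓ , ℕ.s≤s ℓ≤2k , cons (γ-arc N α β γ δ u u-odd ≋-refl) walk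

  NA-far : ∀ {k} p q → DistGe N G p q k → DistGe M NA (+ 2 * p) (+ 2 * q) (2 *ℕ k)
  NA-far {k} p q far ℓ ℓ<2k walk with double-or-suc-double ℓ
  ... | m , inj₁ refl
    with DSG-walk-project 2 (+ 0) {p = p} (walk-map NA²⇒G′ (walk-⇒² m walk))
                          (≋-reflexive (sym (ℤ.+-identityʳ (+ 2 * p))))
  ...   | q′ , 2q≋2q′ , G-walk = far m m<k (walk-≋-end G-walk (≋-sym q≋q′))
    where
    m<k : m ℕ.< k
    m<k = ℕ.*-cancelˡ-< 2 m k (subst (ℕ._< 2 *ℕ k) (double≡2* m) ℓ<2k)
    q≋q′ : q ≋ q′ [mod N ]
    q≋q′ = ≋-affine⁻¹ {N} 2 (+ 0) (≋-trans (≋-reflexive (ℤ.+-identityʳ (+ 2 * q))) 2q≋2q′)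
  -- An odd walk from 2p continues, after its first arc, in the odd coset 1 + 2ℤ, missing 2q.
  NA-far p q far ℓ ℓ<2k (cons {w = w} arc rest) | m , inj₂ refl
    with odd⇒2*+1 w (arc-from-even N α β γ δ α-odd β-odd (+ 2 * p) w (even-2* p) arc)
  ... | t , refl with DSG-walk-project {N} 2 (+ 1) {p = t} (walk-map NA²⇒G′ (walk-⇒² m rest)) ≋-refl
  ...   | q′ , 2q≋2q′+1 , _ = odd-2*+1 q′ (even-≋ 2∣M (≋-sym 2q≋2q′+1) (even-2* q))

theorem3p1 : (N : ℕ) → 1 ≤ N → (a b : ℤ) → a ≢ b →
    gcd N (gcd ∣ a ∣ ∣ b ∣) ≡ 1 →
    (k : ℕ) → HasDiameter N (DSGAdj N a b) k →
    ∃[ D ] (HasDiameter (2 *ℕ N)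
              (NAAdj (2 *ℕ N) -[1+ 0 ] (+ 2 * (b - a) - + 1) (+ 2 * a + + 1) (- (+ 2 * b) + + 1)) D
            × 2 *ℕ k ≤ D × D ≤ suc (2 *ℕ k))
-- The hypotheses a ≢ b and gcd N (gcd ∣ a ∣ ∣ b ∣) ≡ 1 only make G a connected double-step
-- graph, which is already implied by its having a diameter.
theorem3p1 N 1≤N a b _ _ k (G-within , x , y , G-far) =
  diameter-between (2 *ℕ k) (NA-walk? N _ _ _ _)
    (λ u v → NA-within N a b G-within (vtx u) (vtx v))
    (double-fin x , double-fin y ,
     subst₂ (λ u v → DistGe _ _ u v (2 *ℕ k)) (sym (vtx-double-fin x)) (sym (vtx-double-fin y))
       (NA-far N a b (vtx x) (vtx y) G-far))
  where
  instance
    N-nonZero : ℕ.NonZero N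
    N-nonZero = ℕ.>-nonZero 1≤N
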